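{- Let $Q=(q_k)_{k\ge1}$ be a sequence of integers with $q_k>1$, let $\varepsilon_k\in\{0,1,\dots,q_k-1\}$ for all $k$, and let $x=\sum_{k=1}^\infty\frac{\varepsilon_k}{q_1q_2\cdots q_k}$. For $n\ge0$ put $\sigma^n(x)=\sum_{k=n+1}^\infty\frac{\varepsilon_k}{q_{n+1}\cdots q_k}$. If $\sigma^n(x)=x$ for all positive integers $n$, then $\frac{\varepsilon_n}{q_n-1}=x$ for all positive integers $n$ (in particular $\frac{\varepsilon_n}{q_n-1}$ does not depend on $n$). -}

module Defs where

open import Data.Nat using (ℕ; zero; suc; _+_; _*_; _≤_)
open import Data.Integer using (+_)
open import Data.Rational using (ℚ; 0ℚ; _/_; _-_; ∣_∣; _<_) renaming (_+_ to _+ℚ_; _≤_ to _≤ℚ_)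
open import Data.Product using (∃-syntax)

-- a / b as a rational; convention a / 0 = 0 (never used under the
-- hypotheses, since all denominators are then ≥ 1).
frac : ℕ → ℕ → ℚ
frac a zero    = 0ℚ
frac a (suc b) = (+ a) / suc b

-- Sequences are 1-indexed functions ℕ → ℕ (the value at 0 is ignored).
-- prodQ q n m = q_{n+1} q_{n+2} ⋯ q_{n+m}   (empty product = 1)
prodQ : (ℕ → ℕ) → ℕ → ℕ → ℕ
prodQ q n zero    = 1
prodQ q n (suc m) = prodQ q n m * q (n + suc m)

-- tailPartial q ε n m = Σ_{k=n+1}^{n+m} ε_k / (q_{n+1} ⋯ q_k),
-- the m-th partial sum of the series defining σⁿ(x).
tailPartial : (ℕ → ℕ) → (ℕ → ℕ) → ℕ → ℕ → ℚ
tailPartial q ε n zero    = 0ℚ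
tailPartial q ε n (suc m) =
  tailPartial q ε n m +ℚ frac (ε (n + suc m)) (prodQ q n (suc m))

SameLimit : (ℕ → ℚ) → (ℕ → ℚ) → Set
SameLimit a b = ∀ (δ : ℚ) → 0ℚ < δ → ∃[ N ] (∀ m → N ≤ m → ∣ a m - b m ∣ ≤ℚ δ)

ConvergesTo : (ℕ → ℚ) → ℚ → Set
ConvergesTo a r = ∀ (δ : ℚ) → 0ℚ < δ → ∃[ N ] (∀ m → N ≤ m → ∣ a m - r ∣ ≤ℚ δ)

-- Write A, B, C for the partial sums of x, σⁿ⁻¹x and σⁿx, u = 1/qₙ and f = εₙ/qₙ.
-- Peeling off the first digit gives B(m+1) = f + u C(m) exactly, and ρ = εₙ/(qₙ-1)
-- is the fixed point of y ↦ f + u y; hence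
--   A - ρ = qₙ/(qₙ-1) · ((A(m) - B(m+1)) + u (C(m) - A(m))).
-- Both brackets tend to 0: the second by hypothesis, the first because
-- σⁿ⁻¹x = x and consecutive partial sums of x differ by at most 1/(m+1),
-- as q₁⋯qₘ ≥ m+1.

module Submission where

open import Defs
open import Data.Nat using (ℕ; zero; suc; z≤n; s≤s; _⊔_; _≤_; _<_; _∸_)
import Data.Nat as ℕ
import Data.Nat.Properties as ℕP
open import Data.Nat.Solver using () renaming (module +-*-Solver to ℕSolver)
open import Data.Integer using (+_; +[1+_]; +≤+)
import Data.Integer as ℤ
import Data.Integer.Properties as ℤP
open import Data.Rational
  using (ℚ; mkℚ; 0ℚ; 1ℚ; ½; ∣_∣; toℚᵘ; _+_; _*_; -_; _-_; 1/_; Positive; positive; nonNegative)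
  renaming (_≤_ to _≤ℚ_; _<_ to _<ℚ_)
import Data.Rational.Properties as ℚP
open import Data.Rational.Solver using () renaming (module +-*-Solver to ℚSolver)
import Data.Rational.Unnormalised as ℚᵘ
import Data.Rational.Unnormalised.Properties as ℚᵘP
open import Data.Product using (∃-syntax; _,_; proj₁; proj₂)
open import Function using (_∘_)
open import Relation.Binary.PropositionalEquality
  using (_≡_; refl; sym; trans; cong; cong₂; subst; module ≡-Reasoning)

private
  variable
    a b s t : ℕ → ℚ
    q ε : ℕ → ℕ

-- SameLimit a b and ConvergesTo a r unfold to Null (λ m → a m - b m) and Null (λ m → a m - r).
Null : (ℕ → ℚ) → Set
Null s = ∀ (δ : ℚ) → 0ℚ <ℚ δ → ∃[ N ] (∀ m → N ≤ m → ∣ s m ∣ ≤ℚ δ)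

Null-cong : (∀ m → s m ≡ t m) → Null s → Null t
Null-cong s≡t s→0 δ 0<δ with s→0 δ 0<δ
... | N , bound = N , λ m N≤m → subst (λ x → ∣ x ∣ ≤ℚ δ) (s≡t m) (bound m N≤m)

Null-neg : Null s → Null (λ m → - s m)
Null-neg {s} s→0 δ 0<δ with s→0 δ 0<δ
... | N , bound = N , λ m N≤m → subst (_≤ℚ δ) (sym (ℚP.∣-p∣≡∣p∣ (s m))) (bound m N≤m)

Null-+ : Null s → Null t → Null (λ m → s m + t m)
Null-+ {s} {t} s→0 t→0 δ 0<δ
  with s→0 (½ * δ) (ℚP.*-monoʳ-<-pos ½ 0<δ) | t→0 (½ * δ) (ℚP.*-monoʳ-<-pos ½ 0<δ)
... | M , s-bound | N , t-bound = M ⊔ N , bound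
  where
  open ℚP.≤-Reasoning
  open ℚSolver
  bound : ∀ m → M ⊔ N ≤ m → ∣ s m + t m ∣ ≤ℚ δ
  bound m M⊔N≤m = begin
    ∣ s m + t m ∣      ≤⟨ ℚP.∣p+q∣≤∣p∣+∣q∣ (s m) (t m) ⟩
    ∣ s m ∣ + ∣ t m ∣  ≤⟨ ℚP.+-mono-≤ (s-bound m (ℕP.m⊔n≤o⇒m≤o M N M⊔N≤m))
                                      (t-bound m (ℕP.m⊔n≤o⇒n≤o M N M⊔N≤m)) ⟩
    ½ * δ + ½ * δ      ≡⟨ solve 1 (λ x → con ½ :* x :+ con ½ :* x := x) refl δ ⟩
    δ                  ∎

Null-*ˡ : ∀ c → Null s → Null (λ m → c * s m)
Null-*ˡ {s} c s→0 δ 0<δ = N , bound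
  where
  K = 1ℚ + ∣ c ∣
  instance
    K-pos : Positive K
    K-pos = ℚP.pos+nonNeg⇒pos 1ℚ ∣ c ∣ {{ℚP.∣-∣-nonNeg c}}
    K-nonZero = ℚP.pos⇒nonZero K
  δ/K = δ * 1/ K
  0<δ/K : 0ℚ <ℚ δ/K
  0<δ/K = ℚP.positive⁻¹ δ/K {{ℚP.pos*pos⇒pos δ {{positive 0<δ}} (1/ K) {{ℚP.1/pos⇒pos K}}}}
  N = proj₁ (s→0 δ/K 0<δ/K)
  open ℚP.≤-Reasoning
  open ℚSolver
  bound : ∀ m → N ≤ m → ∣ c * s m ∣ ≤ℚ δ
  bound m N≤m = begin
    ∣ c * s m ∣     ≡⟨ ℚP.∣p*q∣≡∣p∣*∣q∣ c (s m) ⟩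
    ∣ c ∣ * ∣ s m ∣ ≤⟨ ℚP.*-monoˡ-≤-nonNeg ∣ c ∣ {{ℚP.∣-∣-nonNeg c}}
                         (proj₂ (s→0 δ/K 0<δ/K) m N≤m) ⟩
    ∣ c ∣ * δ/K     ≡⟨ cong (_* δ/K) (ℚP.+-identityˡ ∣ c ∣) ⟨
    (0ℚ + ∣ c ∣) * δ/K ≤⟨ ℚP.*-monoʳ-≤-nonNeg δ/K {{nonNegative (ℚP.<⇒≤ 0<δ/K)}}
                           (ℚP.+-monoˡ-≤ ∣ c ∣ (ℚP.nonNegative⁻¹ 1ℚ)) ⟩
    K * (δ * 1/ K)  ≡⟨ solve 3 (λ k d k⁻¹ → k :* (d :* k⁻¹) := d :* (k :* k⁻¹)) refl K δ (1/ K) ⟩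
    δ * (K * 1/ K)  ≡⟨ cong (δ *_) (ℚP.*-inverseʳ K) ⟩
    δ * 1ℚ          ≡⟨ ℚP.*-identityʳ δ ⟩
    δ               ∎

Null-∘suc : Null s → Null (s ∘ suc)
Null-∘suc s→0 δ 0<δ with s→0 δ 0<δ
... | N , bound = N , λ m N≤m → bound (suc m) (ℕP.m≤n⇒m≤1+n N≤m)

SameLimit-refl : SameLimit a a
SameLimit-refl {a} δ 0<δ = 0 , λ m _ → begin
  ∣ a m - a m ∣ ≡⟨ cong ∣_∣ (ℚP.+-inverseʳ (a m)) ⟩
  0ℚ           ≤⟨ ℚP.<⇒≤ 0<δ ⟩
  δ            ∎
  where open ℚP.≤-Reasoning

SameLimit-sym : SameLimit a b → SameLimit b a
SameLimit-sym {a} {b} =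
  Null-cong (λ m → solve 2 (λ x y → :- (x :- y) := y :- x) refl (a m) (b m)) ∘ Null-neg
  where open ℚSolver

SameLimit-trans : ∀ {c} → SameLimit a b → SameLimit b c → SameLimit a c
SameLimit-trans {a} {b} {c} a≈b b≈c = Null-cong
  (λ m → solve 3 (λ x y z → (x :- y) :+ (y :- z) := x :- z) refl (a m) (b m) (c m)) (Null-+ a≈b b≈c)
  where open ℚSolver

toℚᵘ-frac : ∀ a b → toℚᵘ (frac a (suc b)) ℚᵘ.≃ ℚᵘ.mkℚᵘ (+ a) b
toℚᵘ-frac a b = ℚP.toℚᵘ-fromℚᵘ (ℚᵘ.mkℚᵘ (+ a) b)

frac-≡ : ∀ a d c d' → 1 ≤ d → 1 ≤ d' → a ℕ.* d' ≡ c ℕ.* d → frac a d ≡ frac c d'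
frac-≡ a (suc b) c (suc b') _ _ ad'≡cd = ℚP.toℚᵘ-injective (begin
  toℚᵘ (frac a (suc b))  ≈⟨ toℚᵘ-frac a b ⟩
  ℚᵘ.mkℚᵘ (+ a) b        ≈⟨ ℚᵘ.*≡* (trans (sym (ℤP.pos-* a (suc b')))
                                       (trans (cong +_ ad'≡cd) (ℤP.pos-* c (suc b)))) ⟩
  ℚᵘ.mkℚᵘ (+ c) b'       ≈⟨ toℚᵘ-frac c b' ⟨
  toℚᵘ (frac c (suc b')) ∎)
  where open ℚᵘP.≃-Reasoning

frac-≤ : ∀ a d c d' → 1 ≤ d → 1 ≤ d' → a ℕ.* d' ≤ c ℕ.* d → frac a d ≤ℚ frac c d'
frac-≤ a (suc b) c (suc b') _ _ ad'≤cd = ℚP.toℚᵘ-cancel-≤ (begin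
  toℚᵘ (frac a (suc b))  ≃⟨ toℚᵘ-frac a b ⟩
  ℚᵘ.mkℚᵘ (+ a) b        ≤⟨ ℚᵘ.*≤* (ℤP.≤-trans (ℤP.≤-reflexive (sym (ℤP.pos-* a (suc b'))))
                              (ℤP.≤-trans (+≤+ ad'≤cd) (ℤP.≤-reflexive (ℤP.pos-* c (suc b))))) ⟩
  ℚᵘ.mkℚᵘ (+ c) b'       ≃⟨ toℚᵘ-frac c b' ⟨
  toℚᵘ (frac c (suc b')) ∎)
  where open ℚᵘP.≤-Reasoning

frac-* : ∀ a c {d d'} → 1 ≤ d → 1 ≤ d' → frac a d * frac c d' ≡ frac (a ℕ.* c) (d ℕ.* d')
frac-* a c {suc b} {suc b'} _ _ = ℚP.toℚᵘ-injective (begin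
  toℚᵘ (frac a (suc b) * frac c (suc b'))
    ≈⟨ ℚP.toℚᵘ-homo-* (frac a (suc b)) (frac c (suc b')) ⟩
  toℚᵘ (frac a (suc b)) ℚᵘ.* toℚᵘ (frac c (suc b'))     ≈⟨ ℚᵘP.*-cong (toℚᵘ-frac a b) (toℚᵘ-frac c b') ⟩
  ℚᵘ.mkℚᵘ (+ a ℤ.* + c) (b' ℕ.+ b ℕ.* suc b')           ≡⟨ cong (λ n → ℚᵘ.mkℚᵘ n _) (ℤP.pos-* a c) ⟨
  ℚᵘ.mkℚᵘ (+ (a ℕ.* c)) (b' ℕ.+ b ℕ.* suc b')           ≈⟨ toℚᵘ-frac (a ℕ.* c) (b' ℕ.+ b ℕ.* suc b') ⟨
  toℚᵘ (frac (a ℕ.* c) (suc b ℕ.* suc b'))              ∎)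
  where open ℚᵘP.≃-Reasoning

frac-+ : ∀ a c {d d'} → 1 ≤ d → 1 ≤ d' → frac a d + frac c d' ≡ frac (a ℕ.* d' ℕ.+ c ℕ.* d) (d ℕ.* d')
frac-+ a c {suc b} {suc b'} _ _ = ℚP.toℚᵘ-injective (begin
  toℚᵘ (frac a (suc b) + frac c (suc b'))
    ≈⟨ ℚP.toℚᵘ-homo-+ (frac a (suc b)) (frac c (suc b')) ⟩
  toℚᵘ (frac a (suc b)) ℚᵘ.+ toℚᵘ (frac c (suc b'))     ≈⟨ ℚᵘP.+-cong (toℚᵘ-frac a b) (toℚᵘ-frac c b') ⟩
  ℚᵘ.mkℚᵘ (+ a ℤ.* + suc b' ℤ.+ + c ℤ.* + suc b) (b' ℕ.+ b ℕ.* suc b')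
    ≡⟨ cong (λ n → ℚᵘ.mkℚᵘ n _) numerator ⟩
  ℚᵘ.mkℚᵘ (+ (a ℕ.* suc b' ℕ.+ c ℕ.* suc b)) (b' ℕ.+ b ℕ.* suc b')
    ≈⟨ toℚᵘ-frac (a ℕ.* suc b' ℕ.+ c ℕ.* suc b) (b' ℕ.+ b ℕ.* suc b') ⟨
  toℚᵘ (frac (a ℕ.* suc b' ℕ.+ c ℕ.* suc b) (suc b ℕ.* suc b')) ∎)
  where
  open ℚᵘP.≃-Reasoning
  numerator : + a ℤ.* + suc b' ℤ.+ + c ℤ.* + suc b ≡ + (a ℕ.* suc b' ℕ.+ c ℕ.* suc b)
  numerator = trans (cong₂ ℤ._+_ (sym (ℤP.pos-* a (suc b'))) (sym (ℤP.pos-* c (suc b))))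
                    (sym (ℤP.pos-+ (a ℕ.* suc b') (c ℕ.* suc b)))

frac-self : ∀ {d} → 1 ≤ d → frac d d ≡ 1ℚ
frac-self {d} 1≤d = frac-≡ d d 1 1 1≤d (s≤s z≤n) (ℕP.*-comm d 1)

frac-split : ∀ a {d d'} → 1 ≤ d → 1 ≤ d' → frac a (d ℕ.* d') ≡ frac 1 d * frac a d'
frac-split a {d} {d'} 1≤d 1≤d' =
  sym (trans (frac-* 1 a 1≤d 1≤d') (cong (λ n → frac n (d ℕ.* d')) (ℕP.*-identityˡ a)))

frac-fixedPoint : ∀ a {c} → 1 < c → frac a (c ∸ 1) ≡ frac a c + frac 1 c * frac a (c ∸ 1)
frac-fixedPoint a {suc zero} (s≤s ())
frac-fixedPoint a {c@(suc (suc d))} _ = sym (begin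
  frac a c + frac 1 c * frac a (suc d)  ≡⟨ cong (λ x → frac a c + x) (frac-split a c≥1 (s≤s z≤n)) ⟨
  frac a c + frac a (c ℕ.* suc d)       ≡⟨ frac-+ a a c≥1 (ℕP.*-mono-≤ c≥1 (s≤s z≤n)) ⟩
  frac (a ℕ.* (c ℕ.* suc d) ℕ.+ a ℕ.* c) (c ℕ.* (c ℕ.* suc d))
    ≡⟨ frac-≡ (a ℕ.* (c ℕ.* suc d) ℕ.+ a ℕ.* c) (c ℕ.* (c ℕ.* suc d)) a (suc d)
              (ℕP.*-mono-≤ c≥1 (ℕP.*-mono-≤ c≥1 (s≤s z≤n))) (s≤s z≤n)
              (solve 2 (λ a d → let c = con 2 :+ d; c-1 = con 1 :+ d in
                           (a :* (c :* c-1) :+ a :* c) :* c-1 := a :* (c :* (c :* c-1))) refl a d) ⟩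
  frac a (suc d)                        ∎)
  where
  open ≡-Reasoning
  open ℕSolver
  c≥1 : 1 ≤ c
  c≥1 = s≤s z≤n

0≤frac : ∀ a {d} → 1 ≤ d → 0ℚ ≤ℚ frac a d
0≤frac a {d} 1≤d = frac-≤ 0 1 a d (s≤s z≤n) 1≤d z≤n

archimedean : ∀ δ → .{{Positive δ}} → ∃[ D ] frac 1 (suc D) ≤ℚ δ
archimedean (mkℚ +[1+ n ] D _) = D , ℚP.toℚᵘ-cancel-≤ (ℚᵘP.≤-respˡ-≃ (ℚᵘP.≃-sym (toℚᵘ-frac 1 D))
  (ℚᵘ.*≤* (+≤+ (ℕP.*-monoˡ-≤ (suc D) {1} {suc n} (s≤s z≤n)))))

≤1/suc⇒Null : (∀ m → ∣ s m ∣ ≤ℚ frac 1 (suc m)) → Null s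
≤1/suc⇒Null {s} s≤1/suc δ 0<δ with archimedean δ {{positive 0<δ}}
... | D , 1/sucD≤δ = D , λ m D≤m → begin
  ∣ s m ∣         ≤⟨ s≤1/suc m ⟩
  frac 1 (suc m) ≤⟨ frac-≤ 1 (suc m) 1 (suc D) (s≤s z≤n) (s≤s z≤n) (ℕP.*-monoʳ-≤ 1 (s≤s D≤m)) ⟩
  frac 1 (suc D) ≤⟨ 1/sucD≤δ ⟩
  δ              ∎
  where open ℚP.≤-Reasoning

1≤n+suc : ∀ n m → 1 ≤ n ℕ.+ suc m
1≤n+suc n m = ℕP.≤-trans (s≤s z≤n) (ℕP.m≤n+m (suc m) n)

>1⇒≥1 : (∀ j → 1 ≤ j → 1 < q j) → ∀ j → 1 ≤ j → 1 ≤ q j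
>1⇒≥1 q>1 j 1≤j = ℕP.<⇒≤ (q>1 j 1≤j)

prodQ-positive : (∀ j → 1 ≤ j → 1 ≤ q j) → ∀ n m → 1 ≤ prodQ q n m
prodQ-positive q≥1 n zero    = s≤s z≤n
prodQ-positive q≥1 n (suc m) = ℕP.*-mono-≤ (prodQ-positive q≥1 n m) (q≥1 _ (1≤n+suc n m))

prodQ-grows : (∀ j → 1 ≤ j → 1 < q j) → ∀ n m → suc m ≤ prodQ q n m
prodQ-grows q>1 n zero    = s≤s z≤n
prodQ-grows q>1 n (suc m) =
  ℕP.<-≤-trans (ℕP.m<m*n (suc m) 2 (s≤s (s≤s z≤n)))
               (ℕP.*-mono-≤ (prodQ-grows q>1 n m) (q>1 _ (1≤n+suc n m)))

prodQ-sucˡ : ∀ n m → prodQ q n (suc m) ≡ q (suc n) ℕ.* prodQ q (suc n) m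
prodQ-sucˡ {q} n zero rewrite ℕP.+-comm n 1 = ℕP.*-comm 1 (q (suc n))
prodQ-sucˡ {q} n (suc m) rewrite prodQ-sucˡ {q} n m | ℕP.+-suc n (suc m) =
  ℕP.*-assoc (q (suc n)) (prodQ q (suc n) m) (q (suc (n ℕ.+ suc m)))

tailPartial-sucˡ : (∀ j → 1 ≤ j → 1 ≤ q j) → ∀ n m →
  tailPartial q ε n (suc m)
    ≡ frac (ε (suc n)) (q (suc n)) + frac 1 (q (suc n)) * tailPartial q ε (suc n) m
tailPartial-sucˡ {q} {ε} q≥1 n zero rewrite ℕP.+-comm n 1 | ℕP.*-identityˡ (q (suc n)) =
  solve 2 (λ f u → con 0ℚ :+ f := f :+ u :* con 0ℚ) refl
          (frac (ε (suc n)) (q (suc n))) (frac 1 (q (suc n)))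
  where open ℚSolver
tailPartial-sucˡ {q} {ε} q≥1 n (suc m) = begin
  tailPartial q ε n (suc m) + frac (ε (n ℕ.+ suc (suc m))) (prodQ q n (suc (suc m)))
    ≡⟨ cong₂ _+_ (tailPartial-sucˡ q≥1 n m)
                 (cong₂ frac (cong ε (ℕP.+-suc n (suc m))) (prodQ-sucˡ n (suc m))) ⟩
  (f + u * T) + frac e (q (suc n) ℕ.* P)
    ≡⟨ cong (λ x → (f + u * T) + x)
            (frac-split e (q≥1 (suc n) (s≤s z≤n)) (prodQ-positive q≥1 (suc n) (suc m))) ⟩
  (f + u * T) + u * frac e P
    ≡⟨ solve 4 (λ f u T F → (f :+ u :* T) :+ u :* F := f :+ u :* (T :+ F)) refl f u T (frac e P) ⟩
  f + u * (T + frac e P) ∎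
  where
  open ≡-Reasoning
  open ℚSolver
  f = frac (ε (suc n)) (q (suc n))
  u = frac 1 (q (suc n))
  T = tailPartial q ε (suc n) m
  e = ε (suc n ℕ.+ suc m)
  P = prodQ q (suc n) (suc m)

tailPartial-term-≤ : (∀ j → 1 ≤ j → 1 < q j) → (∀ j → 1 ≤ j → ε j < q j) → ∀ n m →
  frac (ε (n ℕ.+ suc m)) (prodQ q n (suc m)) ≤ℚ frac 1 (suc m)
tailPartial-term-≤ {q} {ε} q>1 ε<q n m =
  frac-≤ (ε j) (prodQ q n (suc m)) 1 (suc m)
         (prodQ-positive (>1⇒≥1 q>1) n (suc m)) (s≤s z≤n) (begin
    ε j ℕ.* suc m                ≤⟨ ℕP.*-mono-≤ (ℕP.<⇒≤ (ε<q j (1≤n+suc n m))) (prodQ-grows q>1 n m) ⟩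
    q j ℕ.* prodQ q n m          ≡⟨ ℕP.*-comm (q j) (prodQ q n m) ⟩
    prodQ q n m ℕ.* q j          ≡⟨ ℕP.*-identityˡ (prodQ q n m ℕ.* q j) ⟨
    1 ℕ.* (prodQ q n m ℕ.* q j)  ∎)
  where
  open ℕP.≤-Reasoning
  j = n ℕ.+ suc m

SameLimit-tailPartial-∘suc : (∀ j → 1 ≤ j → 1 < q j) → (∀ j → 1 ≤ j → ε j < q j) → ∀ n →
  SameLimit (tailPartial q ε n) (tailPartial q ε n ∘ suc)
SameLimit-tailPartial-∘suc {q} {ε} q>1 ε<q n = ≤1/suc⇒Null λ m →
  let T = tailPartial q ε n m
      t = frac (ε (n ℕ.+ suc m)) (prodQ q n (suc m))
  in begin
    ∣ T - (T + t) ∣ ≡⟨ cong ∣_∣ (solve 2 (λ T t → T :- (T :+ t) := :- t) refl T t) ⟩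
    ∣ - t ∣         ≡⟨ ℚP.∣-p∣≡∣p∣ t ⟩
    ∣ t ∣           ≡⟨ ℚP.0≤p⇒∣p∣≡p
                         (0≤frac (ε (n ℕ.+ suc m)) (prodQ-positive (>1⇒≥1 q>1) n (suc m))) ⟩
    t               ≤⟨ tailPartial-term-≤ q>1 ε<q n m ⟩
    frac 1 (suc m)  ∎
  where
  open ℚP.≤-Reasoning
  open ℚSolver

fixedPoint-deviation : ∀ {u X f ρ} → X ≡ 1ℚ + u * X → ρ ≡ f + u * ρ →
  ∀ A B C → B ≡ f + u * C → X * ((A - B) + u * (C - A)) ≡ A - ρ
fixedPoint-deviation {u} {X} {f} {ρ} X-fixed ρ-fixed A B C B≡ = begin
  X * ((A - B) + u * (C - A))                  ≡⟨ cong (λ b → X * ((A - b) + u * (C - A))) B≡ ⟩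
  X * ((A - (f + u * C)) + u * (C - A))        ≡⟨ cong (λ g → X * ((A - (g + u * C)) + u * (C - A))) f≡ ⟩
  X * ((A - ((ρ - u * ρ) + u * C)) + u * (C - A))
    ≡⟨ solve 5 (λ X u A C ρ → X :* ((A :- ((ρ :- u :* ρ) :+ u :* C)) :+ u :* (C :- A))
                           := X :* (A :- u :* A) :- X :* (ρ :- u :* ρ)) refl X u A C ρ ⟩
  X * (A - u * A) - X * (ρ - u * ρ)           ≡⟨ cong₂ _-_ (X-inverts A) (X-inverts ρ) ⟩
  A - ρ                                        ∎
  where
  open ≡-Reasoning
  open ℚSolver
  f≡ : f ≡ ρ - u * ρ
  f≡ = sym (trans (cong (λ r → r - u * ρ) ρ-fixed)
                  (solve 3 (λ f u ρ → (f :+ u :* ρ) :- u :* ρ := f) refl f u ρ))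
  X-inverts : ∀ y → X * (y - u * y) ≡ y
  X-inverts y = begin
    X * (y - u * y)           ≡⟨ solve 3 (λ X u y → X :* (y :- u :* y) := (X :- u :* X) :* y) refl X u y ⟩
    (X - u * X) * y           ≡⟨ cong (λ x → (x - u * X) * y) X-fixed ⟩
    ((1ℚ + u * X) - u * X) * y ≡⟨ solve 3 (λ X u y → ((con 1ℚ :+ u :* X) :- u :* X) :* y := y) refl X u y ⟩
    y                         ∎

lemma2 : (q ε : ℕ → ℕ)
    → (∀ k → 1 ≤ k → 1 < q k)
    → (∀ k → 1 ≤ k → ε k < q k)
    → (∀ n → 1 ≤ n → SameLimit (tailPartial q ε n) (tailPartial q ε 0))
    → ∀ n → 1 ≤ n → ConvergesTo (tailPartial q ε 0) (frac (ε n) (q n ∸ 1))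
lemma2 q ε q>1 ε<q σⁿx≈x n@(suc k) _ =
  Null-cong (λ m → fixedPoint-deviation {u = u} {f = frac (ε n) c} X-fixed ρ-fixed
                     (T 0 m) (T k (suc m)) (T n m) (tailPartial-sucˡ (>1⇒≥1 q>1) k m))
            (Null-*ˡ X (Null-+ x≈σᵏx∘suc (Null-*ˡ u (σⁿx≈x n (s≤s z≤n)))))
  where
  T = tailPartial q ε
  c = q n
  u = frac 1 c
  X = frac c (c ∸ 1)
  X-fixed : X ≡ 1ℚ + u * X
  X-fixed = trans (frac-fixedPoint c (q>1 n (s≤s z≤n)))
                  (cong (_+ u * X) (frac-self (>1⇒≥1 q>1 n (s≤s z≤n))))
  ρ-fixed : frac (ε n) (c ∸ 1) ≡ frac (ε n) c + u * frac (ε n) (c ∸ 1)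
  ρ-fixed = frac-fixedPoint (ε n) (q>1 n (s≤s z≤n))
  σᵏx≈x : ∀ k → SameLimit (T k) (T 0)
  σᵏx≈x zero    = SameLimit-refl {T 0}
  σᵏx≈x (suc k) = σⁿx≈x (suc k) (s≤s z≤n)
  x≈σᵏx∘suc : SameLimit (T 0) (T k ∘ suc)
  x≈σᵏx∘suc = SameLimit-trans {T 0} {T 0 ∘ suc} (SameLimit-tailPartial-∘suc q>1 ε<q 0)
                (SameLimit-sym {T k ∘ suc} (Null-∘suc (σᵏx≈x k)))
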